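{- An $\ell r$-multisemigroup $(X,\odot,\ell,r)$ is local (i.e. $r(x)=\ell(y)\Rightarrow x\odot y\neq\emptyset$ for all $x,y\in X$) if and only if for all $x,y\in X$, $\ell(x\odot\ell(y))\subseteq\ell(x\odot y)$ and $r(r(x)\odot y)\subseteq r(x\odot y)$.
   Context: A multimagma is a non-empty set $X$ with $\odot:X\times X\to\mathcal{P}X$, extended to subsets by $A\odot B=\bigcup\{a\odot b\mid a\in A,b\in B\}$ (with $x\odot B=\{x\}\odot B$ etc.). $D_{xy}$ means $x\odot y\neq\emptyset$. An $\ell r$-multisemigroup is a multimagma with $\ell,r:X\to X$ such that $x\odot(y\odot z)=(x\odot y)\odot z$ for all $x,y,z$, and $D_{xy}\Rightarrow r(x)=\ell(y)$, $\ell(x)\odot x=\{x\}$, $x\odot r(x)=\{x\}$ for all $x,y$. For $A\subseteq X$, $\ell(A)=\{\ell(a)\mid a\in A\}$ and $r(A)=\{r(a)\mid a\in A\}$. -}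

module Defs where

open import Level using (Level; _⊔_; suc)
open import Data.Product using (Σ; ∃; _×_; _,_)
open import Relation.Binary.PropositionalEquality using (_≡_)
open import Relation.Unary using (Pred; _⊆_)

-- Subsets of X are predicates X → Set.
-- A multioperation X × X → P X, as a ternary relation: (x ⊙ y) z  means  z ∈ x ⊙ y.
MultiOp : ∀ {a} (X : Set a) → Set (suc a)
MultiOp {a} X = X → X → Pred X a

module _ {a} {X : Set a} (_⊙_ : MultiOp X) where

  _⊙ˢ_ : Pred X a → Pred X a → Pred X a
  (A ⊙ˢ B) z = Σ X λ u → Σ X λ v → A u × B v × (u ⊙ v) z

  ⟦_⟧ : X → Pred X a
  ⟦ x ⟧ y = x ≡ y

  _≐_ : Pred X a → Pred X a → Set a
  A ≐ B = (A ⊆ B) × (B ⊆ A)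

  D : X → X → Set a
  D x y = ∃ λ z → (x ⊙ y) z

image : ∀ {a} {X : Set a} → (X → X) → Pred X a → Pred X a
image {X = X} f A w = Σ X λ u → A u × f u ≡ w

record IsLRMultisemigroup {a} {X : Set a} (_⊙_ : MultiOp X) (ℓ r : X → X) : Set a where
  field
    assoc : ∀ x y z → _≐_ _⊙_ (_⊙ˢ_ _⊙_ (⟦_⟧ _⊙_ x) (y ⊙ z)) (_⊙ˢ_ _⊙_ (x ⊙ y) (⟦_⟧ _⊙_ z))
    D⇒r≡ℓ : ∀ x y → D _⊙_ x y → r x ≡ ℓ y
    ℓ-unit : ∀ x → _≐_ _⊙_ (ℓ x ⊙ x) (⟦_⟧ _⊙_ x)
    r-unit : ∀ x → _≐_ _⊙_ (x ⊙ r x) (⟦_⟧ _⊙_ x)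

IsLocal : ∀ {a} {X : Set a} (_⊙_ : MultiOp X) (ℓ r : X → X) → Set a
IsLocal _⊙_ ℓ r = ∀ x y → r x ≡ ℓ y → D _⊙_ x y

{-# OPTIONS --safe #-}
-- Every product x ⊙ y is either empty or lies over the single pair (ℓ x, r y):
-- ℓ(x ⊙ y) ⊆ {ℓ x} and r(x ⊙ y) ⊆ {r y}. Hence if locality makes x ⊙ y
-- nonempty whenever x ⊙ ℓ y or r x ⊙ y is, the inclusions hold. Conversely,
-- if r x = ℓ y then x ∈ x ⊙ r x = x ⊙ ℓ y, so ℓ(x ⊙ ℓ y) is nonempty and the
-- first inclusion forces x ⊙ y ≠ ∅.
module Submission where

open import Defs
open import Data.Product using (_×_; _,_; proj₁; proj₂)
open import Function.Bundles using (_⇔_; mk⇔)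
open import Relation.Unary using (_⊆_)
open import Relation.Binary.PropositionalEquality using (_≡_; refl; sym; trans; subst)

module LRMultisemigroupProperties {a} {X : Set a} {_⊙_ : MultiOp X} {ℓ r : X → X}
                                  (S : IsLRMultisemigroup _⊙_ ℓ r) where
  open IsLRMultisemigroup S

  ∈-ℓ⊙ : ∀ x → (ℓ x ⊙ x) x
  ∈-ℓ⊙ x = proj₂ (ℓ-unit x) refl

  ∈-⊙r : ∀ x → (x ⊙ r x) x
  ∈-⊙r x = proj₂ (r-unit x) refl

  r∘ℓ≡ℓ : ∀ x → r (ℓ x) ≡ ℓ x
  r∘ℓ≡ℓ x = D⇒r≡ℓ (ℓ x) x (x , ∈-ℓ⊙ x)

  ℓ∘r≡r : ∀ x → ℓ (r x) ≡ r x
  ℓ∘r≡r x = sym (D⇒r≡ℓ x (r x) (x , ∈-⊙r x))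

  ℓ-idem : ∀ x → ℓ (ℓ x) ≡ ℓ x
  ℓ-idem x = trans (sym (D⇒r≡ℓ (ℓ x) (ℓ x) (ℓ x , ℓx∈ℓx⊙ℓx))) (r∘ℓ≡ℓ x)
    where
    ℓx∈ℓx⊙ℓx : (ℓ x ⊙ ℓ x) (ℓ x)
    ℓx∈ℓx⊙ℓx = subst (λ t → (ℓ x ⊙ t) (ℓ x)) (r∘ℓ≡ℓ x) (∈-⊙r (ℓ x))

  r-idem : ∀ x → r (r x) ≡ r x
  r-idem x = trans (D⇒r≡ℓ (r x) (r x) (r x , rx∈rx⊙rx)) (ℓ∘r≡r x)
    where
    rx∈rx⊙rx : (r x ⊙ r x) (r x)
    rx∈rx⊙rx = subst (λ t → (t ⊙ r x) (r x)) (ℓ∘r≡r x) (∈-ℓ⊙ (r x))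

  -- Associativity moves ℓ v ⊙ v ∋ v into ℓ v ⊙ (x ⊙ y) = (ℓ v ⊙ x) ⊙ y,
  -- so D (ℓ v) x and hence ℓ v = r (ℓ v) = ℓ x.
  ℓ-⊙ : ∀ {x y v} → (x ⊙ y) v → ℓ v ≡ ℓ x
  ℓ-⊙ {x} {y} {v} v∈x⊙y
    with proj₁ (assoc (ℓ v) x y) (ℓ v , v , refl , v∈x⊙y , ∈-ℓ⊙ v)
  ... | t , _ , t∈ℓv⊙x , _ = trans (sym (r∘ℓ≡ℓ v)) (D⇒r≡ℓ (ℓ v) x (t , t∈ℓv⊙x))

  r-⊙ : ∀ {x y v} → (x ⊙ y) v → r v ≡ r y
  r-⊙ {x} {y} {v} v∈x⊙y
    with proj₂ (assoc x y (r v)) (v , r v , v∈x⊙y , refl , ∈-⊙r v)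
  ... | _ , t , _ , t∈y⊙rv , _ = sym (trans (D⇒r≡ℓ y (r v) (t , t∈y⊙rv)) (ℓ∘r≡r v))

  D-ℓʳ⇒r≡ℓ : ∀ {x y} → D _⊙_ x (ℓ y) → r x ≡ ℓ y
  D-ℓʳ⇒r≡ℓ {x} {y} d = trans (D⇒r≡ℓ x (ℓ y) d) (ℓ-idem y)

  D-rˡ⇒r≡ℓ : ∀ {x y} → D _⊙_ (r x) y → r x ≡ ℓ y
  D-rˡ⇒r≡ℓ {x} {y} d = trans (sym (r-idem x)) (D⇒r≡ℓ (r x) y d)

  image-ℓ-⊙ : ∀ {x y z} → D _⊙_ x y → image ℓ (x ⊙ z) ⊆ image ℓ (x ⊙ y)
  image-ℓ-⊙ (v , v∈x⊙y) (u , u∈x⊙z , refl) = v , v∈x⊙y , trans (ℓ-⊙ v∈x⊙y) (sym (ℓ-⊙ u∈x⊙z))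

  image-r-⊙ : ∀ {x y z} → D _⊙_ x y → image r (z ⊙ y) ⊆ image r (x ⊙ y)
  image-r-⊙ (v , v∈x⊙y) (u , u∈z⊙y , refl) = v , v∈x⊙y , trans (r-⊙ v∈x⊙y) (sym (r-⊙ u∈z⊙y))

  image-ℓ-⊙ℓ-nonempty : ∀ {x y} → r x ≡ ℓ y → image ℓ (x ⊙ ℓ y) (ℓ x)
  image-ℓ-⊙ℓ-nonempty {x} r≡ℓ = x , subst (λ t → (x ⊙ t) x) r≡ℓ (∈-⊙r x) , refl

proposition3p6 : ∀ {a} {X : Set a} (x₀ : X) (_⊙_ : MultiOp X) (ℓ r : X → X)
    → IsLRMultisemigroup _⊙_ ℓ r
    → IsLocal _⊙_ ℓ r
      ⇔ (∀ x y → (image ℓ (x ⊙ ℓ y) ⊆ image ℓ (x ⊙ y))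
               × (image r (r x ⊙ y) ⊆ image r (x ⊙ y)))
proposition3p6 _ _⊙_ ℓ r S = mk⇔ inclusions local
  where
  open LRMultisemigroupProperties S

  inclusions : IsLocal _⊙_ ℓ r → ∀ x y → (image ℓ (x ⊙ ℓ y) ⊆ image ℓ (x ⊙ y))
                                        × (image r (r x ⊙ y) ⊆ image r (x ⊙ y))
  inclusions loc x y = ℓ-inclusion , r-inclusion
    where
    ℓ-inclusion : image ℓ (x ⊙ ℓ y) ⊆ image ℓ (x ⊙ y)
    ℓ-inclusion w@(u , u∈x⊙ℓy , _) = image-ℓ-⊙ (loc x y (D-ℓʳ⇒r≡ℓ (u , u∈x⊙ℓy))) w
    r-inclusion : image r (r x ⊙ y) ⊆ image r (x ⊙ y)
    r-inclusion w@(u , u∈rx⊙y , _) = image-r-⊙ (loc x y (D-rˡ⇒r≡ℓ (u , u∈rx⊙y))) w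

  local : (∀ x y → (image ℓ (x ⊙ ℓ y) ⊆ image ℓ (x ⊙ y))
                 × (image r (r x ⊙ y) ⊆ image r (x ⊙ y))) → IsLocal _⊙_ ℓ r
  local incl x y r≡ℓ with proj₁ (incl x y) (image-ℓ-⊙ℓ-nonempty r≡ℓ)
  ... | v , v∈x⊙y , _ = v , v∈x⊙y
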